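{- Let $p\in\{11,17\}$ and let $a,b,c\in\mathbb{F}_p$ with $a\neq 0$ satisfy $$18a^3+325\,bc=0 \qquad\text{and}\qquad b^5=2c^4 .$$ Let $P(x)=x^5+ax^2+bx+c\in\mathbb{F}_p[x]$. Then there exist $u,v,w,z\in\mathbb{F}_p$ with $uz-vw\neq 0$ such that $P$ divides the polynomial $$H(x)=u\,x^{p+1}+v\,x^{p}+w\,x+z$$ in $\mathbb{F}_p[x]$ (that is, $P$ divides a projective polynomial of order $1$ over $\mathbb{F}_p$).
   Context: A projective polynomial of order $t$ over a field $K$ of characteristic $p$ is a polynomial $ux^{r+1}+vx^r+wx+z$ with $r=p^t$ and $(u,v,w,z)\in K^4$ satisfying $uz-vw\neq 0$. -}

module Defs where

open import Data.Nat using (ℕ; zero; suc; _+_; _*_; _∸_; _^_; _≡ᵇ_; NonZero)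
open import Data.Nat.DivMod using (_%_)
open import Data.Bool using (if_then_else_)
open import Data.List using (List; []; _∷_; map; upTo)
open import Data.Nat.ListAction using (sum)
open import Data.Fin using (Fin; toℕ)
open import Data.Product using (∃)
open import Relation.Binary.PropositionalEquality using (_≡_)

-- Polynomials over F_p are represented by coefficient functions ℕ → ℕ
-- (coefficient of x^k), with coefficients read modulo p.

coeffL : List ℕ → ℕ → ℕ
coeffL []       _       = 0
coeffL (x ∷ xs) zero    = x
coeffL (x ∷ xs) (suc k) = coeffL xs k

δ : ℕ → ℕ → ℕ
δ k m = if k ≡ᵇ m then 1 else 0

conv : (ℕ → ℕ) → (ℕ → ℕ) → ℕ → ℕ
conv f g k = sum (map (λ i → f i * g (k ∸ i)) (upTo (suc k)))

PolyDivides : (p : ℕ) → .{{NonZero p}} → (ℕ → ℕ) → (ℕ → ℕ) → Set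
PolyDivides p f g =
  ∃ λ (Q : List (Fin p)) → ∀ k → conv f (coeffL (map toℕ Q)) k % p ≡ g k % p

quinticP : ℕ → ℕ → ℕ → ℕ → ℕ
quinticP a b c k = δ k 5 + a * δ k 2 + b * δ k 1 + c * δ k 0

projPoly : ℕ → ℕ → ℕ → ℕ → ℕ → ℕ → ℕ
projPoly p u v w z k = u * δ k (suc p) + v * δ k p + w * δ k 1 + z * δ k 0

module Submission where

-- For p ∈ {11, 17} the hypotheses cut out a finite set of
-- triples (a, b, c) ∈ F_p³, so the theorem is a finite statement; we prove it
-- by checking an explicit certificate for every triple.  A certificate for
-- (a, b, c) is a tuple (u, v, w, z) together with a quotient Q such that
-- P · Q = H coefficientwise mod p, where H = u x^(p+1) + v x^p + w x + z.
--
-- The only genuinely infinite part is "coefficientwise": the identity must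
-- hold for every index k.  We handle it with the notion of bounded support
-- (`Below f n`: all coefficients of index ≥ n vanish).  Supports add under
-- Cauchy products, so P · Q and H both vanish from some explicit N on, and
-- it suffices to compare the first N coefficients (`agree-from-prefix`).

open import Defs
open import Data.Nat using (ℕ; zero; suc; _+_; _*_; _^_; _∸_; _≤_; _≤?_; _≟_; _≡ᵇ_; NonZero; s≤s; z≤n)
open import Data.Nat.Properties using (≡ᵇ⇒≡; ≤-trans; ≤-<-connex; <⇒≢; m≤n+m; ∸-monoˡ-≤; ∸-monoʳ-≤; m+n∸m≡n; *-zeroʳ)
open import Data.Nat.DivMod using (_%_; m%n<n)
open import Data.Nat.ListAction using (sum)
open import Data.Fin using (Fin; toℕ; fromℕ<)
open import Data.Fin.Properties using (all?; toℕ-fromℕ<)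
open import Data.Sum using (_⊎_; inj₁; inj₂)
open import Data.Product using (∃; _×_; _,_)
open import Data.List using (List; []; _∷_; map; upTo; length)
open import Data.Bool using (true; false; T; _∧_; if_then_else_)
open import Data.Unit using (tt)
open import Data.Empty using (⊥-elim)
open import Relation.Nullary using (Dec; ¬?)
open import Relation.Nullary.Decidable using (_→-dec_; _×-dec_; toWitness)
open import Relation.Binary.PropositionalEquality using (_≡_; _≢_; refl; sym; cong₂; subst)

Below : (ℕ → ℕ) → ℕ → Set
Below f n = ∀ k → n ≤ k → f k ≡ 0

Below-mono : ∀ {f m n} → m ≤ n → Below f m → Below f n
Below-mono m≤n below k n≤k = below k (≤-trans m≤n n≤k)

Below-+ : ∀ {f g n} → Below f n → Below g n → Below (λ k → f k + g k) n
Below-+ f-below g-below k n≤k = cong₂ _+_ (f-below k n≤k) (g-below k n≤k)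

Below-scale : ∀ {f n} a → Below f n → Below (λ k → a * f k) n
Below-scale {f} a below k n≤k = subst (λ t → a * t ≡ 0) (sym (below k n≤k)) (*-zeroʳ a)

δ-below : ∀ m → Below (λ k → δ k m) (suc m)
δ-below m k m<k with k ≡ᵇ m in eq
... | true  = ⊥-elim (<⇒≢ m<k (sym (≡ᵇ⇒≡ k m (subst T (sym eq) tt))))
... | false = refl

quinticP-below : ∀ a b c → Below (quinticP a b c) 6
quinticP-below a b c =
  Below-+ (Below-+ (Below-+ (δ-below 5)
                            (Below-scale a (Below-mono (s≤s (s≤s (s≤s z≤n))) (δ-below 2))))
                   (Below-scale b (Below-mono (s≤s (s≤s z≤n)) (δ-below 1))))
          (Below-scale c (Below-mono (s≤s z≤n) (δ-below 0)))

projPoly-below : ∀ p u v w z → Below (projPoly p u v w z) (2 + p)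
projPoly-below p u v w z =
  Below-+ (Below-+ (Below-+ (Below-scale u (δ-below (suc p)))
                            (Below-scale v (Below-mono (m≤n+m (suc p) 1) (δ-below p))))
                   (Below-scale w (Below-mono (s≤s (s≤s z≤n)) (δ-below 1))))
          (Below-scale z (Below-mono (s≤s z≤n) (δ-below 0)))

coeffL-below : ∀ xs → Below (coeffL xs) (length xs)
coeffL-below []       k       _          = refl
coeffL-below (x ∷ xs) (suc k) (s≤s len≤k) = coeffL-below xs k len≤k

sum-zero : (h : ℕ → ℕ) → (∀ i → h i ≡ 0) → ∀ is → sum (map h is) ≡ 0
sum-zero h zero-terms []       = refl
sum-zero h zero-terms (i ∷ is) = cong₂ _+_ (zero-terms i) (sum-zero h zero-terms is)

-- deg (f · g) < m + n when deg f < m and deg g < n: in each term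
-- f i · g (k - i) either i ≥ m, or i < m and then k - i ≥ n.
conv-below : ∀ {f g m n} → Below f m → Below g n → Below (conv f g) (m + n)
conv-below {f} {g} {m} {n} f-below g-below k m+n≤k = sum-zero _ term-zero (upTo (suc k))
  where
  term-zero : ∀ i → f i * g (k ∸ i) ≡ 0
  term-zero i with ≤-<-connex m i
  ... | inj₁ m≤i = cong₂ _*_ (f-below i m≤i) refl
  ... | inj₂ i<m = subst (λ t → f i * t ≡ 0) (sym (g-below (k ∸ i) n≤k∸i)) (*-zeroʳ (f i))
    where
    n≤k∸i : n ≤ k ∸ i
    n≤k∸i = subst (_≤ k ∸ i) (m+n∸m≡n m n)
                  (≤-trans (∸-monoʳ-≤ (m + n) (≤-trans (m≤n+m i 1) i<m)) (∸-monoˡ-≤ i m+n≤k))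

agree-from-prefix : ∀ p .{{_ : NonZero p}} {f g N} → Below f N → Below g N →
  (∀ (i : Fin N) → f (toℕ i) % p ≡ g (toℕ i) % p) → ∀ k → f k % p ≡ g k % p
agree-from-prefix p {f} {g} {N} f-below g-below prefix k with ≤-<-connex N k
... | inj₁ N≤k rewrite f-below k N≤k | g-below k N≤k = refl
... | inj₂ k<N = subst (λ j → f j % p ≡ g j % p) (toℕ-fromℕ< k<N) (prefix (fromℕ< k<N))

DividesProjective : (p : ℕ) → .{{NonZero p}} → (a b c : Fin p) → Set
DividesProjective p a b c =
  ∃ λ (u : Fin p) → ∃ λ (v : Fin p) → ∃ λ (w : Fin p) → ∃ λ (z : Fin p) →
    ((toℕ u * toℕ z) % p ≢ (toℕ v * toℕ w) % p) ×
    PolyDivides p (quinticP (toℕ a) (toℕ b) (toℕ c))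
      (projPoly p (toℕ u) (toℕ v) (toℕ w) (toℕ z))

record Witness : Set where
  constructor witness
  field
    u v w z  : ℕ
    quotient : List ℕ

record Entry : Set where
  constructor entry
  field
    a b c : ℕ
    claim : Witness

-- The witness filed under (a, b, c); a missing key yields a dummy witness,
-- which the check below rejects.
lookup : List Entry → ℕ → ℕ → ℕ → Witness
lookup []       a b c = witness 0 0 0 0 []
lookup (e ∷ es) a b c =
  if (Entry.a e ≡ᵇ a) ∧ (Entry.b e ≡ᵇ b) ∧ (Entry.c e ≡ᵇ c) then Entry.claim e else lookup es a b c

module Certificates (p : ℕ) .{{_ : NonZero p}} (N : ℕ) (table : List Entry) where

  reduce : ℕ → Fin p
  reduce n = fromℕ< (m%n<n n p)

  Admissible : (a b c : Fin p) → Set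
  Admissible a b c = (toℕ a ≢ 0) × ((18 * toℕ a ^ 3 + 325 * toℕ b * toℕ c) % p ≡ 0) ×
                     (toℕ b ^ 5 % p ≡ (2 * toℕ c ^ 4) % p)

  admissible? : ∀ a b c → Dec (Admissible a b c)
  admissible? a b c = ¬? (toℕ a ≟ 0) ×-dec (_ ≟ 0) ×-dec (_ ≟ _)

  module _ (a b c : Fin p) (certificate : Witness) where
    open Witness certificate

    P : ℕ → ℕ
    P = quinticP (toℕ a) (toℕ b) (toℕ c)

    H : ℕ → ℕ
    H = projPoly p (toℕ (reduce u)) (toℕ (reduce v)) (toℕ (reduce w)) (toℕ (reduce z))

    Q : List (Fin p)
    Q = map reduce quotient

    Valid : Set
    Valid = ((toℕ (reduce u) * toℕ (reduce z)) % p ≢ (toℕ (reduce v) * toℕ (reduce w)) % p) ×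
            (6 + length (map toℕ Q) ≤ N) × (2 + p ≤ N) ×
            (∀ (i : Fin N) → conv P (coeffL (map toℕ Q)) (toℕ i) % p ≡ H (toℕ i) % p)

    valid? : Dec Valid
    valid? = ¬? (_ ≟ _) ×-dec (_ ≤? _) ×-dec (_ ≤? _) ×-dec all? (λ _ → _ ≟ _)

    valid⇒divides : Valid → DividesProjective p a b c
    valid⇒divides (projective , Q-fits , H-fits , prefix) =
      reduce u , reduce v , reduce w , reduce z , projective , Q ,
      agree-from-prefix p
        (Below-mono Q-fits (conv-below (quinticP-below (toℕ a) (toℕ b) (toℕ c))
                                       (coeffL-below (map toℕ Q))))
        (Below-mono H-fits (projPoly-below p (toℕ (reduce u)) (toℕ (reduce v)) (toℕ (reduce w)) (toℕ (reduce z))))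
        prefix

  -- The statement "every admissible triple has a valid certificate in the
  -- table" quantifies over Fin p³ only, hence is decidable.
  Complete : Set
  Complete = ∀ a b c → Admissible a b c → Valid a b c (lookup table (toℕ a) (toℕ b) (toℕ c))

  complete? : Dec Complete
  complete? = all? λ a → all? λ b → all? λ c →
    admissible? a b c →-dec valid? a b c (lookup table (toℕ a) (toℕ b) (toℕ c))

  divides-projective : Complete → ∀ a b c → Admissible a b c → DividesProjective p a b c
  divides-projective complete a b c admissible =
    valid⇒divides a b c (lookup table (toℕ a) (toℕ b) (toℕ c)) (complete a b c admissible)

-- Certificates for all admissible triples (u, v, w, z found by search, Q by
-- dividing H by P); they are verified by `complete?` below.
table11 : List Entry
table11 =
  entry 1 7 9 (witness 1 7 7 2 (10 ∷ 4 ∷ 8 ∷ 8 ∷ 10 ∷ 0 ∷ 7 ∷ 1 ∷ []))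
  ∷ entry 2 10 2 (witness 1 5 5 10 (5 ∷ 5 ∷ 3 ∷ 2 ∷ 9 ∷ 0 ∷ 5 ∷ 1 ∷ []))
  ∷ entry 3 2 9 (witness 1 8 8 8 (7 ∷ 3 ∷ 8 ∷ 7 ∷ 8 ∷ 0 ∷ 8 ∷ 1 ∷ []))
  ∷ entry 4 8 9 (witness 1 2 2 6 (8 ∷ 9 ∷ 8 ∷ 6 ∷ 7 ∷ 0 ∷ 2 ∷ 1 ∷ []))
  ∷ entry 5 6 9 (witness 1 10 10 7 (2 ∷ 1 ∷ 8 ∷ 10 ∷ 6 ∷ 0 ∷ 10 ∷ 1 ∷ []))
  ∷ entry 6 6 2 (witness 1 1 1 7 (9 ∷ 1 ∷ 3 ∷ 10 ∷ 5 ∷ 0 ∷ 1 ∷ 1 ∷ []))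
  ∷ entry 7 8 2 (witness 1 9 9 6 (3 ∷ 9 ∷ 3 ∷ 6 ∷ 4 ∷ 0 ∷ 9 ∷ 1 ∷ []))
  ∷ entry 8 2 2 (witness 1 3 3 8 (4 ∷ 3 ∷ 3 ∷ 7 ∷ 3 ∷ 0 ∷ 3 ∷ 1 ∷ []))
  ∷ entry 9 10 9 (witness 1 6 6 10 (6 ∷ 5 ∷ 8 ∷ 2 ∷ 2 ∷ 0 ∷ 6 ∷ 1 ∷ []))
  ∷ entry 10 7 2 (witness 1 4 4 2 (1 ∷ 4 ∷ 3 ∷ 8 ∷ 1 ∷ 0 ∷ 4 ∷ 1 ∷ []))
  ∷ []

table17 : List Entry
table17 =
  entry 1 15 13 (witness 1 13 13 3 (12 ∷ 12 ∷ 14 ∷ 13 ∷ 14 ∷ 12 ∷ 9 ∷ 2 ∷ 13 ∷ 6 ∷ 16 ∷ 0 ∷ 13 ∷ 1 ∷ []))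
  ∷ entry 2 2 15 (witness 1 2 2 5 (6 ∷ 5 ∷ 11 ∷ 16 ∷ 10 ∷ 12 ∷ 16 ∷ 8 ∷ 15 ∷ 11 ∷ 15 ∷ 0 ∷ 2 ∷ 1 ∷ []))
  ∷ entry 3 9 7 (witness 1 6 6 11 (4 ∷ 3 ∷ 9 ∷ 9 ∷ 4 ∷ 5 ∷ 6 ∷ 1 ∷ 7 ∷ 7 ∷ 14 ∷ 0 ∷ 6 ∷ 1 ∷ []))
  ∷ entry 4 15 16 (witness 1 16 16 14 (3 ∷ 12 ∷ 5 ∷ 4 ∷ 12 ∷ 12 ∷ 2 ∷ 15 ∷ 16 ∷ 6 ∷ 13 ∷ 0 ∷ 16 ∷ 1 ∷ []))
  ∷ entry 5 9 11 (witness 1 7 7 6 (16 ∷ 3 ∷ 15 ∷ 8 ∷ 16 ∷ 5 ∷ 10 ∷ 16 ∷ 11 ∷ 7 ∷ 12 ∷ 0 ∷ 7 ∷ 1 ∷ []))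
  ∷ entry 6 8 12 (witness 1 14 14 7 (2 ∷ 14 ∷ 1 ∷ 15 ∷ 15 ∷ 5 ∷ 5 ∷ 4 ∷ 12 ∷ 10 ∷ 11 ∷ 0 ∷ 14 ∷ 1 ∷ []))
  ∷ entry 7 8 3 (witness 1 12 12 10 (9 ∷ 14 ∷ 4 ∷ 2 ∷ 8 ∷ 5 ∷ 3 ∷ 13 ∷ 3 ∷ 10 ∷ 10 ∷ 0 ∷ 12 ∷ 1 ∷ []))
  ∷ entry 8 2 8 (witness 1 9 9 12 (10 ∷ 5 ∷ 10 ∷ 1 ∷ 11 ∷ 12 ∷ 13 ∷ 9 ∷ 8 ∷ 11 ∷ 9 ∷ 0 ∷ 9 ∷ 1 ∷ []))
  ∷ entry 9 2 9 (witness 1 8 8 12 (7 ∷ 5 ∷ 7 ∷ 1 ∷ 6 ∷ 12 ∷ 4 ∷ 9 ∷ 9 ∷ 11 ∷ 8 ∷ 0 ∷ 8 ∷ 1 ∷ []))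
  ∷ entry 10 8 14 (witness 1 5 5 10 (8 ∷ 14 ∷ 13 ∷ 2 ∷ 9 ∷ 5 ∷ 14 ∷ 13 ∷ 14 ∷ 10 ∷ 7 ∷ 0 ∷ 5 ∷ 1 ∷ []))
  ∷ entry 11 8 5 (witness 1 3 3 7 (15 ∷ 14 ∷ 16 ∷ 15 ∷ 2 ∷ 5 ∷ 12 ∷ 4 ∷ 5 ∷ 10 ∷ 6 ∷ 0 ∷ 3 ∷ 1 ∷ []))
  ∷ entry 12 9 6 (witness 1 10 10 6 (1 ∷ 3 ∷ 2 ∷ 8 ∷ 1 ∷ 5 ∷ 7 ∷ 16 ∷ 6 ∷ 7 ∷ 5 ∷ 0 ∷ 10 ∷ 1 ∷ []))
  ∷ entry 13 15 1 (witness 1 1 1 14 (14 ∷ 12 ∷ 12 ∷ 4 ∷ 5 ∷ 12 ∷ 15 ∷ 15 ∷ 1 ∷ 6 ∷ 4 ∷ 0 ∷ 1 ∷ 1 ∷ []))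
  ∷ entry 14 9 10 (witness 1 11 11 11 (13 ∷ 3 ∷ 8 ∷ 9 ∷ 13 ∷ 5 ∷ 11 ∷ 1 ∷ 10 ∷ 7 ∷ 3 ∷ 0 ∷ 11 ∷ 1 ∷ []))
  ∷ entry 15 2 2 (witness 1 15 15 5 (11 ∷ 5 ∷ 6 ∷ 16 ∷ 7 ∷ 12 ∷ 1 ∷ 8 ∷ 2 ∷ 11 ∷ 2 ∷ 0 ∷ 15 ∷ 1 ∷ []))
  ∷ entry 16 15 4 (witness 1 4 4 3 (5 ∷ 12 ∷ 3 ∷ 13 ∷ 3 ∷ 12 ∷ 8 ∷ 2 ∷ 4 ∷ 6 ∷ 1 ∷ 0 ∷ 4 ∷ 1 ∷ []))
  ∷ []

complete11 : Certificates.Complete 11 14 table11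
complete11 = toWitness {a? = Certificates.complete? 11 14 table11} tt

complete17 : Certificates.Complete 17 20 table17
complete17 = toWitness {a? = Certificates.complete? 17 20 table17} tt

mainTheorem2 : (p : ℕ) → .{{_ : NonZero p}} → (p ≡ 11 ⊎ p ≡ 17) →
    (a b c : Fin p) → toℕ a ≢ 0 →
    (18 * toℕ a ^ 3 + 325 * toℕ b * toℕ c) % p ≡ 0 →
    toℕ b ^ 5 % p ≡ (2 * toℕ c ^ 4) % p →
    ∃ λ (u : Fin p) → ∃ λ (v : Fin p) → ∃ λ (w : Fin p) → ∃ λ (z : Fin p) →
      ((toℕ u * toℕ z) % p ≢ (toℕ v * toℕ w) % p) ×
      PolyDivides p (quinticP (toℕ a) (toℕ b) (toℕ c))
        (projPoly p (toℕ u) (toℕ v) (toℕ w) (toℕ z))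
mainTheorem2 .11 (inj₁ refl) a b c a≢0 h₁ h₂ =
  Certificates.divides-projective 11 14 table11 complete11 a b c (a≢0 , h₁ , h₂)
mainTheorem2 .17 (inj₂ refl) a b c a≢0 h₁ h₂ =
  Certificates.divides-projective 17 20 table17 complete17 a b c (a≢0 , h₁ , h₂)
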